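{- If $G$ is a connected graph of order $n\geq 3$ such that $\Gamma_t(G)<n-1$, then $d_0(G)\leq \min\{n-1,\ \Gamma_t(G)+\gamma_t(G)\}$.
   Context: A total dominating set (TDS) of a graph $G$ without isolated vertices is a set $S\subseteq V(G)$ such that every vertex of $G$ is adjacent to a vertex of $S$. A minimal TDS (MTDS) is a TDS no proper subset of which is a TDS. $\gamma_t(G)$ is the minimum cardinality of a TDS and $\Gamma_t(G)$ the maximum cardinality of an MTDS. For a positive integer $k$, $D_k^t(G)$ is the graph whose vertices are the TDSs of $G$ of cardinality at most $k$, two being adjacent if and only if one is obtained from the other by adding or deleting a single vertex. $d_0(G)$ is the smallest integer $\ell$ such that $D_k^t(G)$ is connected for all $k\geq \ell$. -}

module Defs where

open import Level using (0ℓ)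
open import Data.Nat using (ℕ; _≤_; _<_; _≥_; _∸_; _⊓_)
open import Data.Fin using (Fin)
open import Data.Fin.Subset using (Subset; _∈_; _∉_; _⊂_; ⁅_⁆; _∪_; ∣_∣)
open import Data.Product using (Σ; ∃; _×_)
open import Data.Sum using (_⊎_)
open import Relation.Nullary using (¬_)
open import Relation.Binary.PropositionalEquality using (_≡_)
open import Relation.Binary.Construct.Closure.ReflexiveTransitive using (Star)

record Graph (n : ℕ) : Set₁ where
  field
    Adj     : Fin n → Fin n → Set
    sym     : ∀ {u v} → Adj u v → Adj v u
    irrefl  : ∀ {v} → ¬ Adj v v

open Graph public

Connected : ∀ {n} → Graph n → Set
Connected G = ∀ u v → Star (Adj G) u v

IsTDS : ∀ {n} → Graph n → Subset n → Set
IsTDS G S = ∀ v → ∃ λ u → u ∈ S × Adj G v u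

IsMTDS : ∀ {n} → Graph n → Subset n → Set
IsMTDS G S = IsTDS G S × (∀ T → T ⊂ S → ¬ IsTDS G T)

IsGammaT : ∀ {n} → Graph n → ℕ → Set
IsGammaT G g = (∃ λ S → IsTDS G S × ∣ S ∣ ≡ g) × (∀ S → IsTDS G S → g ≤ ∣ S ∣)

IsUpperGammaT : ∀ {n} → Graph n → ℕ → Set
IsUpperGammaT G m = (∃ λ S → IsMTDS G S × ∣ S ∣ ≡ m) × (∀ S → IsMTDS G S → ∣ S ∣ ≤ m)

InDk : ∀ {n} → Graph n → ℕ → Subset n → Set
InDk G k S = IsTDS G S × ∣ S ∣ ≤ k

AddOne : ∀ {n} → Subset n → Subset n → Set
AddOne A B = ∃ λ v → v ∉ A × B ≡ A ∪ ⁅ v ⁆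

DkEdge : ∀ {n} → Graph n → ℕ → Subset n → Subset n → Set
DkEdge G k A B = InDk G k A × InDk G k B × (AddOne A B ⊎ AddOne B A)

DkConnected : ∀ {n} → Graph n → ℕ → Set
DkConnected G k = ∀ A B → InDk G k A → InDk G k B → Star (DkEdge G k) A B

EventuallyConnectedFrom : ∀ {n} → Graph n → ℕ → Set
EventuallyConnectedFrom G ℓ = ∀ k → ℓ ≤ k → DkConnected G k

IsD0 : ∀ {n} → Graph n → ℕ → Set
IsD0 G d = EventuallyConnectedFrom G d × (∀ ℓ → EventuallyConnectedFrom G ℓ → d ≤ ℓ)

module Submission where

-- Let G have order n, γ_t(G) = γ and Γ_t(G) = Γ < n − 1. Since d₀(G) is the least ℓ
-- from which every D_k^t(G) is connected, it suffices to show D_k^t(G) connected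
-- for k ≥ Γ + γ and for k ≥ n − 1; the goal d ≤ ℓ being decidable, adjacency may be
-- assumed decidable (d₀-below).
--
-- Reconfiguration: a TDS M inside two sets A, C of size ≤ k joins them in D_k^t by
-- deleting down to M and inserting up to C (through). Every TDS contains an MTDS.
--
-- k ≥ Γ + γ: every A reaches a fixed minimum TDS S₀ via an MTDS M ⊆ A and M ∪ S₀.
--
-- k ≥ n − 1: every A reaches some V ∖ {x} via an MTDS M ⊆ A with x ∉ M; V ∖ {x}
-- and V ∖ {y} are joined when x and y are linked by a chain of pairs {a, c} with
-- V ∖ {a, c} a TDS. Any two such x, y are linked: Γ < n − 1 gives each a partner,
-- and a failure of linkage produces vertices of degree two whose neighbourhoods
-- contradict each other (linked-to-pendant, ¬¬linked).

open import Defs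
open import Data.Nat using (ℕ; zero; suc; _≤_; _<_; _∸_; _+_; _⊓_; _≤?_; s≤s)
import Data.Nat.Properties as ℕ
open import Data.Nat.Induction using (<-wellFounded)
open import Data.Fin using (Fin; zero; suc) renaming (_≟_ to _≟ᶠ_)
open import Data.Fin.Properties using (any?; all?; ¬∀⟶∃¬)
open import Data.Fin.Subset
  using (Subset; _∈_; _∉_; _⊆_; ⁅_⁆; _∪_; _─_; _-_; ∁; ⊤; ∣_∣; inside; outside)
open import Data.Fin.Subset.Properties
open import Data.Product using (∃; _×_; _,_; proj₁; proj₂)
open import Data.Sum using (_⊎_; inj₁; inj₂; swap)
open import Data.Empty using (⊥-elim)
open import Data.Vec using (_∷_; []; here; there)
open import Function using (_∘_)
open import Induction.WellFounded using (Acc; acc)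
open import Relation.Nullary using (¬_; Dec; yes; no; contradiction)
open import Relation.Nullary.Decidable
  using (_×-dec_; _→-dec_; decidable-stable; ¬¬-excluded-middle; ¬?)
open import Relation.Binary.PropositionalEquality using (_≡_; _≢_; refl; subst; trans; cong)
  renaming (sym to ≡-sym)
open import Relation.Binary.Construct.Closure.ReflexiveTransitive
  using (Star; ε; _◅_; _◅◅_; reverse)

¬¬-∀-Fin : ∀ n {P : Fin n → Set} → (∀ i → ¬ ¬ P i) → ¬ ¬ (∀ i → P i)
¬¬-∀-Fin zero    ¬¬P k = k (λ ())
¬¬-∀-Fin (suc n) ¬¬P k =
  ¬¬P zero λ P₀ → ¬¬-∀-Fin n (¬¬P ∘ suc) λ Pₛ → k λ { zero → P₀ ; (suc i) → Pₛ i }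

-- Classically every relation on a finite set is decidable; when proving a
-- decidable (hence double-negation stable) goal we may therefore assume it.
¬¬-decidable : ∀ {n} (R : Fin n → Fin n → Set) → ¬ ¬ (∀ u v → Dec (R u v))
¬¬-decidable {n} R = ¬¬-∀-Fin n λ u → ¬¬-∀-Fin n λ v → ¬¬-excluded-middle

∣p∪q∣≤∣p∣+∣q∣ : ∀ {n} (p q : Subset n) → ∣ p ∪ q ∣ ≤ ∣ p ∣ + ∣ q ∣
∣p∪q∣≤∣p∣+∣q∣ []            []            = ℕ.≤-refl
∣p∪q∣≤∣p∣+∣q∣ (inside  ∷ p) (inside  ∷ q) =
  s≤s (ℕ.≤-trans (∣p∪q∣≤∣p∣+∣q∣ p q) (ℕ.+-monoʳ-≤ ∣ p ∣ (ℕ.n≤1+n ∣ q ∣)))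
∣p∪q∣≤∣p∣+∣q∣ (inside  ∷ p) (outside ∷ q) = s≤s (∣p∪q∣≤∣p∣+∣q∣ p q)
∣p∪q∣≤∣p∣+∣q∣ (outside ∷ p) (inside  ∷ q) =
  ℕ.≤-trans (s≤s (∣p∪q∣≤∣p∣+∣q∣ p q)) (ℕ.≤-reflexive (≡-sym (ℕ.+-suc ∣ p ∣ ∣ q ∣)))
∣p∪q∣≤∣p∣+∣q∣ (outside ∷ p) (outside ∷ q) = ∣p∪q∣≤∣p∣+∣q∣ p q

x∈p─q⇒x∉q : ∀ {n} {p q : Subset n} {x} → x ∈ p ─ q → x ∉ q
x∈p─q⇒x∉q {p = _ ∷ p} {inside ∷ q} () here
x∈p─q⇒x∉q {p = _ ∷ p} {_ ∷ q} (there x∈p─q) (there x∈q) = x∈p─q⇒x∉q x∈p─q x∈q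

x∈p-y⁻ : ∀ {n} {p : Subset n} {x y} → x ∈ p - y → x ∈ p × x ≢ y
x∈p-y⁻ {p = p} {y = y} x∈p-y =
  p─q⊆p p ⁅ y ⁆ x∈p-y , x∉⁅y⁆⇒x≢y (x∈p─q⇒x∉q x∈p-y)

⊈⇒∃∉ : ∀ {n} {p q : Subset n} → ¬ p ⊆ q → ∃ λ x → x ∈ p × x ∉ q
⊈⇒∃∉ {n} {p} {q} p⊈q
  with ¬∀⟶∃¬ n (λ x → x ∈ p → x ∈ q) (λ x → (x ∈? p) →-dec (x ∈? q)) (λ f → p⊈q (f _))
... | x , ¬p→q =
  x , decidable-stable (x ∈? p) (λ x∉p → ¬p→q (λ x∈p → contradiction x∈p x∉p)) ,
  λ x∈q → ¬p→q (λ _ → x∈q)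

∣p∣<∣p∪⁅x⁆∣ : ∀ {n} {p : Subset n} {x} → x ∉ p → ∣ p ∣ < ∣ p ∪ ⁅ x ⁆ ∣
∣p∣<∣p∪⁅x⁆∣ {p = p} {x} x∉p =
  p⊂q⇒∣p∣<∣q∣ (p⊆p∪q ⁅ x ⁆ , x , q⊆p∪q p ⁅ x ⁆ (x∈⁅x⁆ x) , x∉p)

p∪⁅x⁆⊆q : ∀ {n} {p q : Subset n} {x} → p ⊆ q → x ∈ q → p ∪ ⁅ x ⁆ ⊆ q
p∪⁅x⁆⊆q {p = p} {x = x} p⊆q x∈q y∈ with x∈p∪q⁻ p ⁅ x ⁆ y∈
... | inj₁ y∈p  = p⊆q y∈p
... | inj₂ y∈⁅x⁆ = subst (_∈ _) (≡-sym (x∈⁅y⁆⇒x≡y x y∈⁅x⁆)) x∈q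

allBut : ∀ {n} → Fin n → Subset n
allBut x = ∁ ⁅ x ⁆

∣allBut∣ : ∀ {n} (x : Fin n) → ∣ allBut x ∣ ≡ n ∸ 1
∣allBut∣ {n} x = trans (∣∁p∣≡n∸∣p∣ ⁅ x ⁆) (cong (n ∸_) (∣⁅x⁆∣≡1 x))

∈allBut⁺ : ∀ {n} {u x : Fin n} → u ≢ x → u ∈ allBut x
∈allBut⁺ = x∉p⇒x∈∁p ∘ x≢y⇒x∉⁅y⁆

∈allBut⁻ : ∀ {n} {u x : Fin n} → u ∈ allBut x → u ≢ x
∈allBut⁻ = x∉⁅y⁆⇒x≢y ∘ x∈∁p⇒x∉p

allBut-x-y⊆allBut-y : ∀ {n} {x y : Fin n} → allBut x - y ⊆ allBut y
allBut-x-y⊆allBut-y u∈ = ∈allBut⁺ (proj₂ (x∈p-y⁻ u∈))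

module TotalDomination {n : ℕ} (G : Graph n) where

  tds-⊆ : ∀ {S T} → IsTDS G S → S ⊆ T → IsTDS G T
  tds-⊆ tS S⊆T v = let (u , u∈S , v~u) = tS v in u , S⊆T u∈S , v~u

  -- Minimality can be tested one vertex at a time: a TDS none of whose
  -- one-vertex deletions is a TDS is an MTDS, because TDSs are upward closed.
  mtds-if-no-deletion : ∀ {S} → IsTDS G S →
    ¬ (∃ λ x → x ∈ S × IsTDS G (S - x)) → IsMTDS G S
  mtds-if-no-deletion tS none = tS , λ { T (T⊆S , x , x∈S , x∉T) tT →
    none (x , x∈S , tds-⊆ tT λ {y} y∈T →
      x∈p∧x≢y⇒x∈p-y (T⊆S y∈T) λ { refl → x∉T y∈T }) }

  Deletable : Fin n → Set
  Deletable x = IsTDS G (allBut x)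

  PairDeletable : Fin n → Fin n → Set
  PairDeletable x y = IsTDS G (allBut x - y)

  pairDeletable-sym : ∀ {x y} → PairDeletable x y → PairDeletable y x
  pairDeletable-sym tS = tds-⊆ tS λ u∈ →
    let (u∈allBut , u≢y) = x∈p-y⁻ u∈ in
    x∈p∧x≢y⇒x∈p-y (∈allBut⁺ u≢y) (∈allBut⁻ u∈allBut)

  Linked : Fin n → Fin n → Set
  Linked = Star PairDeletable

  linked-sym : ∀ {x y} → Linked x y → Linked y x
  linked-sym = reverse pairDeletable-sym

  Pendant : Fin n → Fin n → Fin n → Set
  Pendant v a b = Adj G v a × Adj G v b × (∀ w → Adj G v w → w ≡ a ⊎ w ≡ b)

  pendant-swap : ∀ {v a b} → Pendant v a b → Pendant v b a
  pendant-swap (v~a , v~b , N) = v~b , v~a , λ w v~w → swap (N w v~w)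

  pairDeletable⇒deletable : ∀ {x y} → PairDeletable x y → Deletable y
  pairDeletable⇒deletable tS = tds-⊆ tS allBut-x-y⊆allBut-y

  pendant-≢ : ∀ {v a b v′ a′} → Pendant v a b → Pendant v′ a′ b → a′ ≢ a → a′ ≢ b → v′ ≢ v
  pendant-≢ (_ , _ , N) (v′~a′ , _ , _) a′≢a a′≢b refl with N _ v′~a′
  ... | inj₁ a′≡a = a′≢a a′≡a
  ... | inj₂ a′≡b = a′≢b a′≡b

  -- If v is pendant on {x, y}, V ∖ {x} is a TDS and x, y have neighbours other
  -- than v, then V ∖ {v} is a TDS: only x and y could depend on v.
  pendant-deletable : ∀ {v x y x′ y′} → Pendant v x y → Deletable x →
    Adj G x x′ → x′ ≢ v → Adj G y y′ → y′ ≢ v → Deletable v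
  pendant-deletable {v} (_ , _ , N) dx x~x′ x′≢v y~y′ y′≢v u with dx u
  ... | w , _ , u~w with w ≟ᶠ v
  ...   | no w≢v = w , ∈allBut⁺ w≢v , u~w
  ...   | yes refl with N u (sym G u~w)
  ...     | inj₁ refl = _ , ∈allBut⁺ x′≢v , x~x′
  ...     | inj₂ refl = _ , ∈allBut⁺ y′≢v , y~y′

  -- d₀(G) lies below every ℓ from which D_k^t(G) stays connected. As d ≤ ℓ is
  -- decidable, the connectivity argument may assume that adjacency and linkage
  -- are decidable.
  d₀-below : ∀ {d} ℓ → IsD0 G d →
    ((∀ u v → Dec (Adj G u v)) → (∀ x y → Dec (Linked x y)) → EventuallyConnectedFrom G ℓ) →
    d ≤ ℓ
  d₀-below {d} ℓ (_ , least) connected = decidable-stable (d ≤? ℓ) λ d≰ℓ →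
    ¬¬-decidable (Adj G) λ adj? → ¬¬-decidable Linked λ linked? →
    d≰ℓ (least ℓ (connected adj? linked?))

  module Reconfiguration (k : ℕ) where

    Path : Subset n → Subset n → Set
    Path = Star (DkEdge G k)

    edge-sym : ∀ {A B} → DkEdge G k A B → DkEdge G k B A
    edge-sym (inA , inB , inj₁ A+x) = inB , inA , inj₂ A+x
    edge-sym (inA , inB , inj₂ B+x) = inB , inA , inj₁ B+x

    path-sym : ∀ {A B} → Path A B → Path B A
    path-sym = reverse edge-sym

    insert-edge : ∀ {A x} → IsTDS G A → x ∉ A → ∣ A ∪ ⁅ x ⁆ ∣ ≤ k → DkEdge G k A (A ∪ ⁅ x ⁆)
    insert-edge {A} {x} tA x∉A A+x≤k =
      (tA , ℕ.≤-trans (∣p∣≤∣p∪q∣ A ⁅ x ⁆) A+x≤k) ,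
      (tds-⊆ tA (p⊆p∪q ⁅ x ⁆) , A+x≤k) ,
      inj₁ (x , x∉A , refl)

    grow : ∀ {A C} → Acc _<_ (∣ C ∣ ∸ ∣ A ∣) → IsTDS G A → A ⊆ C → ∣ C ∣ ≤ k → Path A C
    grow {A} {C} (acc smaller) tA A⊆C C≤k with C ⊆? A
    ... | yes C⊆A = subst (Path A) (⊆-antisym A⊆C C⊆A) ε
    ... | no C⊈A with ⊈⇒∃∉ C⊈A
    ...   | x , x∈C , x∉A =
      insert-edge tA x∉A (ℕ.≤-trans A+x≤C C≤k) ◅
      grow (smaller (ℕ.∸-monoʳ-< (∣p∣<∣p∪⁅x⁆∣ x∉A) A+x≤C)) (tds-⊆ tA (p⊆p∪q ⁅ x ⁆)) A+x⊆C C≤k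
      where
      A+x⊆C : A ∪ ⁅ x ⁆ ⊆ C
      A+x⊆C = p∪⁅x⁆⊆q A⊆C x∈C
      A+x≤C : ∣ A ∪ ⁅ x ⁆ ∣ ≤ ∣ C ∣
      A+x≤C = p⊆q⇒∣p∣≤∣q∣ A+x⊆C

    ascend : ∀ {A C} → IsTDS G A → A ⊆ C → ∣ C ∣ ≤ k → Path A C
    ascend {A} {C} = grow (<-wellFounded (∣ C ∣ ∸ ∣ A ∣))

    through : ∀ {A M C} → IsTDS G M → M ⊆ A → M ⊆ C → ∣ A ∣ ≤ k → ∣ C ∣ ≤ k → Path A C
    through tM M⊆A M⊆C A≤k C≤k =
      path-sym (ascend tM M⊆A A≤k) ◅◅ ascend tM M⊆C C≤k

  module WithDecidableAdjacency (adj? : ∀ u v → Dec (Adj G u v)) where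

    tds? : ∀ S → Dec (IsTDS G S)
    tds? S = all? λ v → any? λ u → (u ∈? S) ×-dec adj? v u

    mtds-inside : ∀ A → IsTDS G A → ∃ λ M → IsMTDS G M × M ⊆ A
    mtds-inside A = go A (<-wellFounded ∣ A ∣)
      where
      go : ∀ A → Acc _<_ ∣ A ∣ → IsTDS G A → ∃ λ M → IsMTDS G M × M ⊆ A
      go A (acc smaller) tA with any? (λ x → (x ∈? A) ×-dec tds? (A - x))
      ... | no none = A , mtds-if-no-deletion tA none , λ x∈A → x∈A
      ... | yes (x , x∈A , tA-x) =
        let (M , mM , M⊆A-x) = go (A - x) (smaller (x∈p⇒∣p-x∣<∣p∣ x∈A)) tA-x
        in M , mM , p─q⊆p A ⁅ x ⁆ ∘ M⊆A-x

    connected-above-Γ+γ : ∀ {Γ γ} → IsUpperGammaT G Γ → IsGammaT G γ →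
      ∀ k → Γ + γ ≤ k → DkConnected G k
    connected-above-Γ+γ {Γ} {γ} (_ , ≤Γ) ((S₀ , tS₀ , ∣S₀∣≡γ) , _) k Γ+γ≤k
                        A B (tA , A≤k) (tB , B≤k) =
      to-S₀ tA A≤k ◅◅ path-sym (to-S₀ tB B≤k)
      where
      open Reconfiguration k
      S₀≤k : ∣ S₀ ∣ ≤ k
      S₀≤k = ℕ.≤-trans (ℕ.≤-reflexive ∣S₀∣≡γ) (ℕ.≤-trans (ℕ.m≤n+m γ Γ) Γ+γ≤k)
      to-S₀ : ∀ {A} → IsTDS G A → ∣ A ∣ ≤ k → Path A S₀
      to-S₀ {A} tA A≤k =
        let (M , mM , M⊆A) = mtds-inside A tA
            ∣M∪S₀∣≤k = ℕ.≤-trans (∣p∪q∣≤∣p∣+∣q∣ M S₀)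
                         (ℕ.≤-trans (ℕ.+-mono-≤ (≤Γ M mM) (ℕ.≤-reflexive ∣S₀∣≡γ)) Γ+γ≤k)
        in through (proj₁ mM) M⊆A (p⊆p∪q S₀) A≤k ∣M∪S₀∣≤k ◅◅
           path-sym (through tS₀ ⊆-refl (q⊆p∪q M S₀) S₀≤k ∣M∪S₀∣≤k)

    -- If V ∖ {a} and V ∖ {b} are TDSs but V ∖ {a, b} is not, the vertex left
    -- undominated by V ∖ {a, b} is pendant on {a, b}.
    pendant : ∀ {a b} → Deletable a → Deletable b → ¬ PairDeletable a b → ∃ λ v → Pendant v a b
    pendant {a} {b} da db ¬pab =
      v , neighbour db N , neighbour da (λ w v~w → swap (N w v~w)) , N
      where
      undominated : ∃ λ v → ¬ (∃ λ u → u ∈ allBut a - b × Adj G v u)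
      undominated = ¬∀⟶∃¬ n _ (λ v → any? λ u → (u ∈? (allBut a - b)) ×-dec adj? v u) ¬pab
      v = proj₁ undominated
      N : ∀ w → Adj G v w → w ≡ a ⊎ w ≡ b
      N w v~w with w ≟ᶠ a | w ≟ᶠ b
      ... | yes w≡a | _       = inj₁ w≡a
      ... | no _    | yes w≡b = inj₂ w≡b
      ... | no w≢a  | no w≢b  =
        ⊥-elim (proj₂ undominated (w , x∈p∧x≢y⇒x∈p-y (∈allBut⁺ w≢a) w≢b , v~w))
      neighbour : ∀ {c d} → Deletable d → (∀ w → Adj G v w → w ≡ c ⊎ w ≡ d) → Adj G v c
      neighbour dd N′ with dd v
      ... | u , u∈ , v~u with N′ u v~u
      ...   | inj₁ refl = v~u
      ...   | inj₂ refl = contradiction refl (∈allBut⁻ u∈)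

    module SmallUpperTotalDomination {Γ} (isΓ : IsUpperGammaT G Γ) (Γ<n∸1 : Γ < n ∸ 1) where

      mtds-small : ∀ {M} → IsMTDS G M → ∣ M ∣ < n ∸ 1
      mtds-small mM = ℕ.≤-<-trans (proj₂ isΓ _ mM) Γ<n∸1

      -- V ∖ {a} is too large to be minimal, so some b ≠ a can be deleted along with a.
      partner : ∀ {a} → Deletable a → ∃ λ b → b ≢ a × PairDeletable a b
      partner {a} da with any? (λ b → (b ∈? allBut a) ×-dec tds? (allBut a - b))
      ... | yes (b , b∈ , pab) = b , ∈allBut⁻ b∈ , pab
      ... | no none =
        contradiction (mtds-small (mtds-if-no-deletion da none)) (ℕ.<-irrefl (∣allBut∣ a))

      -- An MTDS is smaller than V, so it misses some vertex.
      mtds-misses : ∀ {M} → IsMTDS G M → ∃ λ x → x ∉ M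
      mtds-misses {M} mM with any? (λ x → ¬? (x ∈? M))
      ... | yes missed = missed
      ... | no none =
        contradiction (ℕ.<-≤-trans (mtds-small mM) (ℕ.≤-trans (ℕ.m∸n≤m n 1) V≤M)) (ℕ.<-irrefl refl)
        where
        V≤M : n ≤ ∣ M ∣
        V≤M = subst (_≤ ∣ M ∣) (∣⊤∣≡n n) (p⊆q⇒∣p∣≤∣q∣ {p = ⊤} λ {x} _ →
                decidable-stable (x ∈? M) (λ x∉M → none (x , x∉M)))

      -- Let x have a partner x′ but not be linked to y, and let v, v′ be
      -- pendant on {x, y} and {x′, y}. If V ∖ {v} is a TDS then v is (classically)
      -- linked to x: otherwise a vertex w pendant on {x, v} exists, and chasing the
      -- neighbourhoods of w, y, v′ forces v = x′, i.e. v linked to x after all.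
      linked-to-pendant : ∀ {x y x′ v v′} → Deletable x → ¬ Linked x y →
        PairDeletable x x′ → x′ ≢ x → Pendant v x y → Pendant v′ x′ y →
        Deletable v → ¬ ¬ Linked x v
      linked-to-pendant dx ¬xy px x′≢x vP@(v~x , v~y , Nv) v′P@(_ , v′~y , Nv′) dv ¬xv
        with pendant dx dv (¬xv ∘ (_◅ ε))
      ... | w , w~x , w~v , Nw with Nv w (sym G w~v)
      ...   | inj₁ refl = irrefl G w~x
      ...   | inj₂ refl with Nw _ (sym G v′~y)
      ...     | inj₂ refl = pendant-≢ vP v′P x′≢x (λ { refl → ¬xy (px ◅ ε) }) refl
      ...     | inj₁ refl with Nv′ _ (sym G v~x)
      ...       | inj₁ refl = ¬xv (px ◅ ε)
      ...       | inj₂ refl = irrefl G v~y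

      -- If x and y were not,
      -- take partners x′, y′ and pendant vertices v, v′, v″ on {x, y}, {x′, y},
      -- {y′, x}; then v is deletable, and by the key step linked to both x and y.
      ¬¬linked : ∀ {x y} → Deletable x → Deletable y → ¬ ¬ Linked x y
      ¬¬linked {x} {y} dx dy ¬xy =
        let (x′ , x′≢x , px) = partner dx
            (y′ , y′≢y , py) = partner dy
            x′≢y : x′ ≢ y
            x′≢y = λ { refl → ¬xy (px ◅ ε) }
            y′≢x : y′ ≢ x
            y′≢x = λ { refl → ¬xy (linked-sym (py ◅ ε)) }
            (v , vP) = pendant dx dy (¬xy ∘ (_◅ ε))
            (v′ , v′P) = pendant (pairDeletable⇒deletable px) dy
                           (λ p → ¬xy (px ◅ p ◅ ε))
            (v″ , v″P) = pendant (pairDeletable⇒deletable py) dx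
                           (λ p → ¬xy (linked-sym (py ◅ p ◅ ε)))
            dv = pendant-deletable vP dx
                   (sym G (proj₁ (proj₂ v″P))) (pendant-≢ (pendant-swap vP) v″P y′≢y y′≢x)
                   (sym G (proj₁ (proj₂ v′P))) (pendant-≢ vP v′P x′≢x x′≢y)
        in linked-to-pendant dx ¬xy px x′≢x vP v′P dv λ xv →
           linked-to-pendant dy (¬xy ∘ linked-sym) py y′≢y (pendant-swap vP) v″P dv λ yv →
           ¬xy (xv ◅◅ linked-sym yv)

      -- Second bound: D_k^t(G) is connected once k ≥ n − 1 (given that linkage is
      -- decidable, which the classical argument above only shows up to ¬¬).
      connected-above-n∸1 : (∀ x y → Dec (Linked x y)) → ∀ k → n ∸ 1 ≤ k → DkConnected G k
      connected-above-n∸1 linked? k n∸1≤k A B (tA , A≤k) (tB , B≤k) =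
        let (x , dx , A→x) = to-allBut tA A≤k
            (y , dy , B→y) = to-allBut tB B≤k
        in A→x ◅◅ hops (linked dx dy) ◅◅ path-sym B→y
        where
        open Reconfiguration k
        allBut≤k : ∀ x → ∣ allBut x ∣ ≤ k
        allBut≤k x = ℕ.≤-trans (ℕ.≤-reflexive (∣allBut∣ x)) n∸1≤k

        linked : ∀ {x y} → Deletable x → Deletable y → Linked x y
        linked {x} {y} dx dy = decidable-stable (linked? x y) (¬¬linked dx dy)

        to-allBut : ∀ {A} → IsTDS G A → ∣ A ∣ ≤ k → ∃ λ x → Deletable x × Path A (allBut x)
        to-allBut {A} tA A≤k =
          let (M , mM , M⊆A) = mtds-inside A tA
              (x , x∉M) = mtds-misses mM
              M⊆allBut : M ⊆ allBut x
              M⊆allBut y∈M = ∈allBut⁺ λ { refl → x∉M y∈M }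
          in x , tds-⊆ (proj₁ mM) M⊆allBut ,
             through (proj₁ mM) M⊆A M⊆allBut A≤k (allBut≤k x)

        hops : ∀ {a c} → Linked a c → Path (allBut a) (allBut c)
        hops ε = ε
        hops {a} (_◅_ {j = c} pac c→) =
          through pac (p─q⊆p (allBut a) ⁅ c ⁆) allBut-x-y⊆allBut-y (allBut≤k a) (allBut≤k c)
          ◅◅ hops c→

theorem2p6 : ∀ {n} (G : Graph n) → 3 ≤ n → Connected G →
    ∀ (g Γ d : ℕ) → IsGammaT G g → IsUpperGammaT G Γ → IsD0 G d →
    Γ < n ∸ 1 → d ≤ (n ∸ 1) ⊓ (Γ + g)
theorem2p6 {n} G _ _ g Γ d isγ isΓ isD0 Γ<n∸1 =
  ℕ.⊓-glb (d₀-below (n ∸ 1) isD0 λ adj? linked? →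
             SmallUpperTotalDomination.connected-above-n∸1 adj? isΓ Γ<n∸1 linked?)
          (d₀-below (Γ + g) isD0 λ adj? _ → connected-above-Γ+γ adj? isΓ isγ)
  where
  open TotalDomination G
  open WithDecidableAdjacency
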